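{- Let $m=3$. For every color $c\in\mathbb Z_5$, the return map $R_c=P_{2,c}\circ P_{1,c}\circ P_{0,c}:A_3\to A_3$ is a single cycle (of length $81$) on $A_3$, where $P_{t,c}(w)=w+q_{d_t(w,c)}$ with $d_0(w,c)=c+4$, $d_1(w,c)=\Lambda_1(Z(w)-1)(c)$, $d_2(w,c)=c+3$.
   Context: Indices in $\mathbb Z_5=\{0,\dots,4\}$. $A_3=\{w\in(\mathbb Z_3)^5:\sum_i w_i=0\}$; $e_i$ standard basis vectors; $q_i=e_i-e_4$ ($i=0,1,2,3$), $q_4=0$. For $w\in A_3$, $Z(w)=\{i:w_i=0\}$ and $Z(w)-1=\{i-1:i\in Z(w)\}$. A table $\Lambda_1$ assigns to subsets $S\subseteq\mathbb Z_5$ permutations $\Lambda_1(S)$ of $\mathbb Z_5$, written $(\Lambda_1(S)(0),\dots,\Lambda_1(S)(4))$, given on representatives by $\Lambda_1(\varnothing)=(0,1,2,3,4)$, $\Lambda_1(\{0\})=(0,1,3,2,4)$, $\Lambda_1(\{0,1\})=(4,1,3,2,0)$, $\Lambda_1(\{0,2\})=(4,1,3,0,2)$, $\Lambda_1(\{0,1,2\})=(1,0,3,4,2)$, $\Lambda_1(\{0,1,3\})=(4,3,0,2,1)$, $\Lambda_1(\{0,1,2,3,4\})=(0,1,2,3,4)$, and extended by cyclic equivariance $\Lambda_1(S+k)(a+k)=\Lambda_1(S)(a)+k\pmod 5$ (this covers all zero-sets of points of $A_3$, none of which has size four). -}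

module Defs where

open import Data.Nat using (ℕ; zero; suc; _+_; _∸_; _<_)
open import Data.Product using (_×_; _,_; ∃-syntax)
open import Data.List using (List) renaming ([] to L[]; _∷_ to _L∷_)
import Data.List as L
open import Relation.Nullary using (¬_)
open import Data.Nat.DivMod using (_mod_)
open import Data.Fin using (Fin; toℕ) renaming (zero to fz; suc to fs)
open import Data.Fin.Subset using (Subset; inside; outside)
open import Data.Vec using (Vec; []; _∷_; lookup; tabulate; updateAt; foldr)
open import Data.Bool using (Bool; true; false; if_then_else_)
open import Data.Maybe using (Maybe; just; nothing)
open import Relation.Nullary using (does)
import Data.Fin.Properties as FinP
import Data.Vec.Properties as VecP
open import Data.Bool.Properties using () renaming (_≟_ to _≟B_)
open import Relation.Binary.PropositionalEquality using (_≡_)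

Z5 : Set
Z5 = Fin 5

Z3 : Set
Z3 = Fin 3

_+₅_ : Z5 → Z5 → Z5
a +₅ b = (toℕ a + toℕ b) mod 5

_-₅_ : Z5 → Z5 → Z5
a -₅ b = (toℕ a + (5 ∸ toℕ b)) mod 5

_+₃_ : Z3 → Z3 → Z3
a +₃ b = (toℕ a + toℕ b) mod 3

_-₃_ : Z3 → Z3 → Z3
a -₃ b = (toℕ a + (3 ∸ toℕ b)) mod 3

k5 : ℕ → Z5
k5 n = n mod 5

Pt : Set
Pt = Vec Z3 5

sum3 : Pt → Z3
sum3 = foldr _ _+₃_ fz

InA3 : Pt → Set
InA3 w = sum3 w ≡ fz

e : Z5 → Pt
e i = tabulate (λ j → if does (FinP._≟_ i j) then fs fz else fz)

_⊕_ : Pt → Pt → Pt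
v ⊕ w = tabulate (λ j → lookup v j +₃ lookup w j)

_⊖_ : Pt → Pt → Pt
v ⊖ w = tabulate (λ j → lookup v j -₃ lookup w j)

q : Z5 → Pt
q i = e i ⊖ e (k5 4)   -- for i = 4 this is e_4 - e_4 = 0

-- Z(w) - 1 = { i - 1 : w_i = 0 } ; i.e. j ∈ Z(w)-1 iff w_{j+1} = 0
Zm1 : Pt → Subset 5
Zm1 w = tabulate (λ j → if does (FinP._≟_ (lookup w (j +₅ k5 1)) fz) then inside else outside)

shiftS : Subset 5 → Z5 → Subset 5
shiftS S k = tabulate (λ j → lookup S (j -₅ k))

fromList : Vec ℕ 5 → Subset 5
fromList = Data.Vec.map (λ { zero → outside ; (suc _) → inside })

Perm5 : Set
Perm5 = Vec Z5 5

perm : ℕ → ℕ → ℕ → ℕ → ℕ → Perm5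
perm a b c d f = k5 a ∷ k5 b ∷ k5 c ∷ k5 d ∷ k5 f ∷ []

-- Representatives S (as 0/1 characteristic vectors) and Λ₁(S), as given in the paper.
reps : List (Subset 5 × Perm5)
reps =
    (fromList (0 ∷ 0 ∷ 0 ∷ 0 ∷ 0 ∷ []) , perm 0 1 2 3 4)
  L.∷ (fromList (1 ∷ 0 ∷ 0 ∷ 0 ∷ 0 ∷ []) , perm 0 1 3 2 4)
  L.∷ (fromList (1 ∷ 1 ∷ 0 ∷ 0 ∷ 0 ∷ []) , perm 4 1 3 2 0)
  L.∷ (fromList (1 ∷ 0 ∷ 1 ∷ 0 ∷ 0 ∷ []) , perm 4 1 3 0 2)
  L.∷ (fromList (1 ∷ 1 ∷ 1 ∷ 0 ∷ 0 ∷ []) , perm 1 0 3 4 2)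
  L.∷ (fromList (1 ∷ 1 ∷ 0 ∷ 1 ∷ 0 ∷ []) , perm 4 3 0 2 1)
  L.∷ (fromList (1 ∷ 1 ∷ 1 ∷ 1 ∷ 1 ∷ []) , perm 0 1 2 3 4)
  L.∷ L.[]

-- Λ₁(R + k) = a ↦ Λ₁(R)(a - k) + k   (cyclic equivariance)
transport : Perm5 → Z5 → Perm5
transport P k = tabulate (λ a → lookup P (a -₅ k) +₅ k)

idPerm : Perm5
idPerm = perm 0 1 2 3 4

search : Subset 5 → List Z5 → Maybe Perm5
search S L.[] = nothing
search S (k L.∷ ks) = go reps
  where
  go : List (Subset 5 × Perm5) → Maybe Perm5
  go L.[] = search S ks
  go ((R , P) L.∷ rs) = if does (VecP.≡-dec _≟B_ S (shiftS R k)) then just (transport P k) else go rs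

-- Λ₁ on all subsets covered by the table (all zero-sets of points of A₃);
-- on the (irrelevant, unused) remaining subsets of size four it defaults to the identity.
Λ₁ : Subset 5 → Perm5
Λ₁ S with search S (k5 0 L.∷ k5 1 L.∷ k5 2 L.∷ k5 3 L.∷ k5 4 L.∷ L.[])
... | just P  = P
... | nothing = idPerm

d0 : Pt → Z5 → Z5
d0 w c = c +₅ k5 4

d1 : Pt → Z5 → Z5
d1 w c = lookup (Λ₁ (Zm1 w)) c

d2 : Pt → Z5 → Z5
d2 w c = c +₅ k5 3

P0 P1 P2 : Z5 → Pt → Pt
P0 c w = w ⊕ q (d0 w c)
P1 c w = w ⊕ q (d1 w c)
P2 c w = w ⊕ q (d2 w c)

Ret : Z5 → Pt → Pt
Ret c w = P2 c (P1 c (P0 c w))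

iter : (Pt → Pt) → ℕ → Pt → Pt
iter f zero w = w
iter f (suc n) w = f (iter f n w)

IsSingleCycleOnA3 : (Pt → Pt) → ℕ → Set
IsSingleCycleOnA3 f n =
    (∀ w → InA3 w → InA3 (f w))
  × (∀ w → InA3 w → iter f n w ≡ w)
  × (∀ w → InA3 w → ∀ k → 0 < k → k < n → ¬ (iter f k w ≡ w))
  × (∀ w v → InA3 w → InA3 v → ∃[ k ] (k < n × iter f k w ≡ v))

-- Each step of Ret c adds three vectors q_i whose coordinates sum to zero, so Ret c
-- maps A₃ to itself.  A self-map of a set is a single n-cycle on it as soon as some
-- orbit returns after n steps, has no repetition before that, and meets every point
-- of the set.  For the orbit of the origin and n = 81 = |A₃| these are finite
-- checks, decided by evaluation.
module Submission where

open import Defs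
open import Algebra.Definitions using (Interchangable)
open import Data.Empty using (⊥-elim)
open import Data.Fin using (Fin) renaming (zero to fz)
open import Data.Fin.Properties using (all?) renaming (_≟_ to _≟ᶠ_)
open import Data.List using (List; []; _∷_; iterate)
import Data.List.Relation.Unary.All as All
open import Data.List.Relation.Unary.AllPairs using (_∷_)
open import Data.List.Relation.Unary.Any using (here; there)
open import Data.Nat
  using (zero; suc; _+_; _*_; _∸_; _<_; _≤_; z≤n; s≤s; NonZero; >-nonZero)
open import Data.Nat.DivMod using (_%_; _/_; m≡m%n+[m/n]*n; m%n<n)
open import Data.Nat.Properties using (+-comm; m∸n+n≡m; <⇒≤; <⇒≢; ≤-<-trans)
open import Data.Product using (_,_; ∃-syntax; _×_)
open import Data.Vec using (Vec; []; _∷_; zipWith)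
import Data.Vec as Vec
import Data.Vec.Properties as Vec
open import Function using (_∘_)
open import Relation.Binary.PropositionalEquality
  using (_≡_; refl; sym; trans; cong; cong₂; subst; module ≡-Reasoning)
open import Relation.Nullary using (Dec; ¬_; map′; _→-dec_)
open import Relation.Nullary.Decidable using (from-yes)
open import Relation.Unary using (Pred; Decidable)

_≟Pt_ : (v w : Pt) → Dec (v ≡ w)
_≟Pt_ = Vec.≡-dec _≟ᶠ_

open import Data.List.Membership.DecPropositional _≟Pt_ using (_∈_; _∈?_)
open import Data.List.Relation.Unary.Unique.DecPropositional _≟Pt_ using (Unique; unique?)

∀-Vec? : ∀ {p k n} {P : Pred (Vec (Fin k) n) p} → Decidable P → Dec (∀ v → P v)
∀-Vec? {n = zero}  P? = map′ (λ { p [] → p }) (λ p → p []) (P? [])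
∀-Vec? {n = suc n} {P = P} P? =
  map′ (λ { p (x ∷ xs) → p x xs }) (λ p x xs → p (x ∷ xs))
       (all? λ x → ∀-Vec? {P = P ∘ (x ∷_)} (P? ∘ (x ∷_)))

+₃-interchange : Interchangable _≡_ _+₃_ _+₃_
+₃-interchange = from-yes (all? {n = 3} λ a → all? λ b → all? λ c → all? λ d →
                   ((a +₃ b) +₃ (c +₃ d)) ≟ᶠ ((a +₃ c) +₃ (b +₃ d)))

sum3-zipWith : ∀ {n} (v w : Vec Z3 n) →
               Vec.foldr (λ _ → Z3) _+₃_ fz (zipWith _+₃_ v w)
                 ≡ Vec.foldr (λ _ → Z3) _+₃_ fz v +₃ Vec.foldr (λ _ → Z3) _+₃_ fz w
sum3-zipWith []      []      = refl
sum3-zipWith (a ∷ v) (b ∷ w) =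
  trans (cong ((a +₃ b) +₃_) (sum3-zipWith v w)) (+₃-interchange a b _ _)

sum3-⊕ : ∀ v w → sum3 (v ⊕ w) ≡ sum3 v +₃ sum3 w
sum3-⊕ v@(_ ∷ _ ∷ _ ∷ _ ∷ _ ∷ []) w@(_ ∷ _ ∷ _ ∷ _ ∷ _ ∷ []) = sum3-zipWith v w

sum3-q : ∀ i → sum3 (q i) ≡ fz
sum3-q = from-yes (all? λ i → sum3 (q i) ≟ᶠ fz)

⊕q-preserves-A3 : ∀ w i → InA3 w → InA3 (w ⊕ q i)
⊕q-preserves-A3 w i w∈A = trans (sum3-⊕ w (q i)) (cong₂ _+₃_ w∈A (sum3-q i))

Ret-preserves-A3 : ∀ c w → InA3 w → InA3 (Ret c w)
Ret-preserves-A3 c w =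
  ⊕q-preserves-A3 w₂ (d2 w₂ c) ∘ ⊕q-preserves-A3 w₁ (d1 w₁ c)
    ∘ ⊕q-preserves-A3 w (d0 w c)
  where
  w₁ = P0 c w
  w₂ = P1 c w₁

module _ (f : Pt → Pt) where

  iter-+ : ∀ m n w → iter f (m + n) w ≡ iter f m (iter f n w)
  iter-+ zero    n w = refl
  iter-+ (suc m) n w = cong f (iter-+ m n w)

  iter-comm : ∀ m n w → iter f m (iter f n w) ≡ iter f n (iter f m w)
  iter-comm m n w = begin
    iter f m (iter f n w) ≡⟨ sym (iter-+ m n w) ⟩
    iter f (m + n) w      ≡⟨ cong (λ k → iter f k w) (+-comm m n) ⟩
    iter f (n + m) w      ≡⟨ iter-+ n m w ⟩
    iter f n (iter f m w) ∎
    where open ≡-Reasoning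

  iter-suc-inner : ∀ k w → iter f k (f w) ≡ iter f (suc k) w
  iter-suc-inner k w = iter-comm k 1 w

  iter-fixed : ∀ {k w} → iter f k w ≡ w → ∀ m → iter f k (iter f m w) ≡ iter f m w
  iter-fixed {k} {w} fixed m = trans (iter-comm k m w) (cong (iter f m) fixed)

  iter-*-period : ∀ {n w} → iter f n w ≡ w → ∀ q → iter f (q * n) w ≡ w
  iter-*-period         period zero    = refl
  iter-*-period {n} {w} period (suc q) =
    trans (iter-+ n (q * n) w) (trans (cong (iter f n) (iter-*-period period q)) period)

  iter-%-period : ∀ {n w} .{{_ : NonZero n}} → iter f n w ≡ w →
                  ∀ k → iter f k w ≡ iter f (k % n) w
  iter-%-period {n} {w} period k = begin
    iter f k w
      ≡⟨ cong (λ i → iter f i w) (m≡m%n+[m/n]*n k n) ⟩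
    iter f (k % n + (k / n) * n) w
      ≡⟨ iter-+ (k % n) ((k / n) * n) w ⟩
    iter f (k % n) (iter f ((k / n) * n) w)
      ≡⟨ cong (iter f (k % n)) (iter-*-period period (k / n)) ⟩
    iter f (k % n) w
      ∎
    where open ≡-Reasoning

  iter∈iterate : ∀ {k n} w → k < n → iter f k w ∈ iterate f w n
  iter∈iterate {zero}  w (s≤s _)   = here refl
  iter∈iterate {suc k} w (s≤s k<n) =
    there (subst (_∈ _) (iter-suc-inner k w) (iter∈iterate (f w) k<n))

  ∈iterate⇒iter : ∀ {n v} w → v ∈ iterate f w n → ∃[ k ] (k < n × iter f k w ≡ v)
  ∈iterate⇒iter {suc n} w (here refl) = 0 , s≤s z≤n , refl
  ∈iterate⇒iter {suc n} w (there v∈) with ∈iterate⇒iter (f w) v∈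
  ... | k , k<n , refl = suc k , s≤s k<n , sym (iter-suc-inner k w)

  iter-injective : ∀ {n w i j} → Unique (iterate f w n) → i < n → j < n →
                   iter f i w ≡ iter f j w → i ≡ j
  iter-injective {i = zero}  {zero}  _ _ _ _ = refl
  iter-injective {suc n} {w} {zero} {suc j} (w∉ ∷ _) _ (s≤s j<n) eq =
    ⊥-elim (All.lookup w∉ (iter∈iterate (f w) j<n)
                       (trans eq (sym (iter-suc-inner j w))))
  iter-injective {suc n} {w} {suc i} {zero} (w∉ ∷ _) (s≤s i<n) _ eq =
    ⊥-elim (All.lookup w∉ (iter∈iterate (f w) i<n)
                       (sym (trans (iter-suc-inner i w) eq)))
  iter-injective {suc n} {w} {suc i} {suc j} (_ ∷ unique) (s≤s i<n) (s≤s j<n) eq =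
    cong suc (iter-injective unique i<n j<n
               (trans (iter-suc-inner i w) (trans eq (sym (iter-suc-inner j w)))))

single-cycle : ∀ f n w₀ → (∀ w → InA3 w → InA3 (f w)) → iter f n w₀ ≡ w₀ →
               Unique (iterate f w₀ n) → (∀ w → InA3 w → w ∈ iterate f w₀ n) →
               IsSingleCycleOnA3 f n
single-cycle f n w₀ preserves period unique covers =
  preserves , returns , minimal , transitive
  where
  back-to-start : ∀ {j} → j ≤ n → iter f (n ∸ j) (iter f j w₀) ≡ w₀
  back-to-start {j} j≤n =
    trans (sym (iter-+ f (n ∸ j) j w₀))
          (trans (cong (λ k → iter f k w₀) (m∸n+n≡m j≤n)) period)

  returns : ∀ w → InA3 w → iter f n w ≡ w
  returns w w∈A with ∈iterate⇒iter f w₀ (covers w w∈A)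
  ... | j , _ , refl = iter-fixed f {n} period j

  minimal : ∀ w → InA3 w → ∀ k → 0 < k → k < n → ¬ iter f k w ≡ w
  minimal w w∈A k 0<k k<n fixed with ∈iterate⇒iter f w₀ (covers w w∈A)
  ... | j , j<n , refl =
    <⇒≢ 0<k (sym (iter-injective f unique k<n (≤-<-trans z≤n k<n) fixes-start))
    where
    fixes-start : iter f k w₀ ≡ w₀
    fixes-start =
      subst (λ v → iter f k v ≡ v) (back-to-start (<⇒≤ j<n))
            (iter-fixed f {k} fixed (n ∸ j))

  transitive : ∀ w v → InA3 w → InA3 v → ∃[ k ] (k < n × iter f k w ≡ v)
  transitive w v w∈A v∈A
    with ∈iterate⇒iter f w₀ (covers w w∈A) | ∈iterate⇒iter f w₀ (covers v v∈A)
  ... | j , j<n , refl | i , _ , refl = k % n , m%n<n k n , (begin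
    iter f (k % n) (iter f j w₀)            ≡⟨ sym (iter-%-period f {n} (returns _ w∈A) k) ⟩
    iter f k (iter f j w₀)                  ≡⟨ iter-+ f i (n ∸ j) _ ⟩
    iter f i (iter f (n ∸ j) (iter f j w₀)) ≡⟨ cong (iter f i) (back-to-start (<⇒≤ j<n)) ⟩
    iter f i w₀                             ∎)
    where
    open ≡-Reasoning
    instance _ = >-nonZero (≤-<-trans z≤n j<n)
    k = i + (n ∸ j)

-- Taking the list as an argument makes Agda evaluate the orbit once, not once per point.
covers? : (L : List Pt) → Dec (∀ w → InA3 w → w ∈ L)
covers? L = ∀-Vec? λ w → (sum3 w ≟ᶠ fz) →-dec (w ∈? L)

origin : Pt
origin = fz ∷ fz ∷ fz ∷ fz ∷ fz ∷ []

Ret-period : ∀ c → iter (Ret c) 81 origin ≡ origin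
Ret-period = from-yes (all? {n = 5} λ c → iter (Ret c) 81 origin ≟Pt origin)

Ret-orbit-unique : ∀ c → Unique (iterate (Ret c) origin 81)
Ret-orbit-unique = from-yes (all? {n = 5} λ c → unique? (iterate (Ret c) origin 81))

Ret-orbit-covers : ∀ c w → InA3 w → w ∈ iterate (Ret c) origin 81
Ret-orbit-covers = from-yes (all? {n = 5} λ c → covers? (iterate (Ret c) origin 81))

mainTheorem12 : ∀ (c : Z5) → IsSingleCycleOnA3 (Ret c) 81
mainTheorem12 c =
  single-cycle (Ret c) 81 origin
    (Ret-preserves-A3 c) (Ret-period c) (Ret-orbit-unique c) (Ret-orbit-covers c)
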